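{- Fix $d\geq 1$. In an $\alpha_d$-tree, all opening stems are incident to black vertices and all closing stems are incident to white vertices. Consequently, the closure of any $\alpha_d$-tree is a bipartite map.
   Context: A blossoming tree is a plane tree rooted at a corner (root vertex $\rho$) whose vertices may carry dangling half-edges: opening stems (outgoing) and closing stems (ingoing); stems count in vertex degrees. A $k$-fractional orientation of a blossoming tree is a map $\mathcal{O}$ from half-edges (including stems) to $\mathbb{Z}_{\ge0}$ with $\mathcal{O}(h_1)+\mathcal{O}(h_2)=k$ on each edge $\{h_1,h_2\}$, $\mathcal{O}(h)=0$ on closing stems and $\mathcal{O}(h)=k$ on opening stems. Outdegree of $v$ = sum of $\mathcal{O}$ over its half-edges. A directed edge $(h_1,h_2)$ is forward if $\mathcal{O}(h_1)>0$; the orientation is accessible if from every vertex there is a path of forward edges to $\rho$. An $\alpha_d$-orientation is a $(d+1)$-fractional orientation with outdegree $d\deg(v)$ at black and $\deg(v)$ at white vertices. An $\alpha_d$-tree is a blossoming tree with a proper black/white vertex coloring, all vertex degrees at most $d$, equipped with an accessible $\alpha_d$-orientation. Closure: stems read clockwise around the tree are matched like parentheses (opening = open), and each matched pair is merged into an edge with the outer face on its left. -}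

module Defs where

open import Data.Nat using (ℕ; zero; suc; _+_; _*_; _∸_; _≤_; _<_)
open import Data.List using (List; []; _∷_; length; map; _++_; zip; reverse)
open import Data.Nat.ListAction using (sum)
open import Data.List.Relation.Unary.All using (All)
open import Data.Maybe using (Maybe; just; nothing)
open import Data.Product using (Σ; _×_; _,_; proj₁; proj₂)
open import Data.Unit using (⊤)
open import Relation.Binary.PropositionalEquality using (_≡_; _≢_)
open import Relation.Binary.Construct.Closure.ReflexiveTransitive using (Star)

-- Blossoming trees (plane trees rooted at a corner, with stems),
-- with a black/white vertex colouring and edge orientation data.
--
-- A vertex is  node c is  where c is its colour and  is  lists the
-- half-edges of the vertex other than the edge to its parent, in
-- clockwise order: for the root starting from the root corner, for a
-- non-root vertex starting right after the edge to its parent.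
-- An item is either a stem (opening / closing) or an edge  edge a t
-- to a child subtree t, where a is the value of the orientation on the
-- half-edge at the parent side (the child side carries k ∸ a, and
-- a ≤ k is required by a k-fractional orientation).

data Color : Set where
  black white : Color

data StemKind : Set where
  opening closing : StemKind

data Tree : Set
data Item : Set

data Tree where
  node : Color → List Item → Tree

data Item where
  stem : StemKind → Item
  edge : ℕ → Tree → Item

data Pos : Tree → Set
data PosI : List Item → Set

data Pos where
  here : ∀ {c is} → Pos (node c is)
  down : ∀ {c is} → PosI is → Pos (node c is)

data PosI where
  hd : ∀ {a t is} → Pos t → PosI (edge a t ∷ is)
  tl : ∀ {x is} → PosI is → PosI (x ∷ is)

root : (t : Tree) → Pos t
root (node c is) = here

data ChildRoot : {is : List Item} → ℕ → PosI is → Set where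
  hdR : ∀ {a t is} → ChildRoot a (hd {a} {t} {is} (root t))
  tlR : ∀ {x is a} {i : PosI is} → ChildRoot a i → ChildRoot a (tl {x} i)

data Dir : Set where
  toChild toParent : Dir

data Step : {t : Tree} → ℕ → Dir → Pos t → Pos t → Set
data StepI : {is : List Item} → ℕ → Dir → PosI is → PosI is → Set

data Step where
  sDown : ∀ {c is a} {i : PosI is} → ChildRoot a i → Step {node c is} a toChild here (down i)
  sUp   : ∀ {c is a} {i : PosI is} → ChildRoot a i → Step {node c is} a toParent (down i) here
  sIn   : ∀ {c is a dir} {i j : PosI is} → StepI a dir i j → Step {node c is} a dir (down i) (down j)

data StepI where
  iHd : ∀ {a' t is a dir} {p q : Pos t} → Step a dir p q → StepI {edge a' t ∷ is} a dir (hd p) (hd q)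
  iTl : ∀ {x is a dir} {i j : PosI is} → StepI a dir i j → StepI {x ∷ is} a dir (tl i) (tl j)

leaveVal : ℕ → ℕ → Dir → ℕ
leaveVal k a toChild  = a
leaveVal k a toParent = k ∸ a

Forward : (k : ℕ) {t : Tree} → Pos t → Pos t → Set
Forward k p q = Σ ℕ λ a → Σ Dir λ dir → Step a dir p q × 0 < leaveVal k a dir

Accessible : ℕ → Tree → Set
Accessible k t = (p : Pos t) → Star (Forward k) p (root t)

TreeAdj : {t : Tree} → Pos t → Pos t → Set
TreeAdj p q = Σ ℕ λ a → Step a toChild p q

colorAt : {t : Tree} → Pos t → Color
colorAtI : {is : List Item} → PosI is → Color
colorAt {node c is} here = c
colorAt (down i) = colorAtI i
colorAtI (hd p) = colorAt p
colorAtI (tl i) = colorAtI i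

-- A vertex is seen as (up, c, is) where
-- up = nothing for the root, and up = just (c' , a) if the parent has
-- colour c' and the edge to the parent has parent-side value a.

Up : Set
Up = Maybe (Color × ℕ)

AllV : (Up → Color → List Item → Set) → Up → Tree → Set
AllVI : (Up → Color → List Item → Set) → Color → List Item → Set
AllV P up (node c is) = P up c is × AllVI P c is
AllVI P c [] = ⊤
AllVI P c (stem _ ∷ is) = AllVI P c is
AllVI P c (edge a t ∷ is) = AllV P (just (c , a)) t × AllVI P c is

edgeVals : List Item → List ℕ
edgeVals [] = []
edgeVals (stem _ ∷ is) = edgeVals is
edgeVals (edge a _ ∷ is) = a ∷ edgeVals is

deg : Up → List Item → ℕ
deg nothing is = length is
deg (just _) is = suc (length is)

itemOut : ℕ → Item → ℕ
itemOut k (stem opening) = k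
itemOut k (stem closing) = 0
itemOut k (edge a _) = a

upOut : ℕ → Up → ℕ
upOut k nothing = 0
upOut k (just (_ , a)) = k ∸ a

outdeg : ℕ → Up → List Item → ℕ
outdeg k up is = upOut k up + sum (map (itemOut k) is)

ProperAt : Up → Color → List Item → Set
ProperAt nothing c is = ⊤
ProperAt (just (c' , _)) c is = c' ≢ c

DegAtMost : ℕ → Up → Color → List Item → Set
DegAtMost d up c is = deg up is ≤ d

FracAt : ℕ → Up → Color → List Item → Set
FracAt k up c is = All (_≤ k) (edgeVals is)

alphaTarget : ℕ → Color → ℕ → ℕ
alphaTarget d black n = d * n
alphaTarget d white n = n

AlphaOutAt : ℕ → Up → Color → List Item → Set
AlphaOutAt d up c is = outdeg (suc d) up is ≡ alphaTarget d c (deg up is)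

AlphaTree : ℕ → Tree → Set
AlphaTree d t =
  AllV ProperAt nothing t ×
  AllV (DegAtMost d) nothing t ×
  AllV (FracAt (suc d)) nothing t ×
  AllV (AlphaOutAt d) nothing t ×
  Accessible (suc d) t

StemOK : Color → Item → Set
StemOK c (stem opening) = c ≡ black
StemOK c (stem closing) = c ≡ white
StemOK c (edge _ _) = ⊤

StemsColored : Tree → Set
StemsColored t = AllV (λ up c is → All (StemOK c) is) nothing t

-- stems in clockwise contour order starting at the root corner
stems : (t : Tree) → List (StemKind × Pos t)
stemsI : {T : Tree} (is : List Item) → Pos T → (PosI is → Pos T) → List (StemKind × Pos T)
stems (node c is) = stemsI is here down
stemsI [] h f = []
stemsI (stem s ∷ is) h f = (s , h) ∷ stemsI is h (λ i → f (tl i))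
stemsI (edge a t ∷ is) h f =
  map (λ x → proj₁ x , f (hd (proj₂ x))) (stems t) ++ stemsI is h (λ i → f (tl i))

-- cyclic parenthesis matching; returns pairs (opening vertex , closing vertex)
matchGo : {P : Set} → List P → List P → List (StemKind × P) → List (P × P)
matchGo st uc [] = zip st (reverse uc)
matchGo st uc ((opening , p) ∷ xs) = matchGo (p ∷ st) uc xs
matchGo (q ∷ st) uc ((closing , p) ∷ xs) = (q , p) ∷ matchGo st uc xs
matchGo [] uc ((closing , p) ∷ xs) = matchGo [] (p ∷ uc) xs

closureEdges : (t : Tree) → List (Pos t × Pos t)
closureEdges t = matchGo [] [] (stems t)

BipartiteClosure : Tree → Set
BipartiteClosure t =
  Σ (Pos t → Color) λ col →
    (∀ {p q : Pos t} → TreeAdj p q → col p ≢ col q) ×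
    All (λ e → col (proj₁ e) ≢ col (proj₂ e)) (closureEdges t)

-- Count outdegrees at a vertex v of degree D ≤ d, with k = d + 1. Every
-- half-edge carries at most k, so the outdegree is at most kD, and at most
-- k(D − 1) if v has a closing stem; an opening stem alone contributes k.
-- At a white vertex the outdegree is D ≤ d < k, so there is no opening stem;
-- at a black vertex it is dD, and dD ≤ k(D − 1) would force k ≤ D, so there
-- is no closing stem. The closure matches each opening stem with a closing
-- one, so every closure edge joins a black to a white vertex, as every tree
-- edge does by properness of the coloring.
module Submission where

open import Defs
open import Data.Nat using (ℕ; _≤_)
open import Data.Product using (_×_)

open import Data.Nat using (suc; _+_; _*_; _∸_; z≤n)
open import Data.Nat.Properties
open import Data.Nat.ListAction using (sum)
open import Data.List using (List; []; _∷_; length; map; zip)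
open import Data.List.Relation.Unary.All as All using (All; []; _∷_)
open import Data.List.Relation.Unary.All.Properties using (map⁺; ++⁺)
open import Data.List.Relation.Unary.Any as Any using (Any; here; there)
open import Data.List.Membership.Propositional using (_∈_)
open import Data.List.Relation.Binary.Permutation.Propositional using (↭-sym)
open import Data.List.Relation.Binary.Permutation.Propositional.Properties
  using (All-resp-↭; ↭-reverse)
open import Data.Maybe using (just; nothing)
open import Data.Product using (_,_; proj₁; proj₂)
open import Data.Unit using (tt)
open import Data.Empty using (⊥-elim)
open import Relation.Binary.PropositionalEquality using (_≡_; _≢_; refl; sym; trans; cong)

AllV-zipWith : {P Q R : Up → Color → List Item → Set} →
  (∀ {up c is} → P up c is → Q up c is → R up c is) →
  ∀ up t → AllV P up t → AllV Q up t → AllV R up t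
AllVI-zipWith : {P Q R : Up → Color → List Item → Set} →
  (∀ {up c is} → P up c is → Q up c is → R up c is) →
  ∀ c is → AllVI P c is → AllVI Q c is → AllVI R c is
AllV-zipWith f up (node c is) (p , ps) (q , qs) = f p q , AllVI-zipWith f c is ps qs
AllVI-zipWith f c [] _ _ = tt
AllVI-zipWith f c (stem _ ∷ is) ps qs = AllVI-zipWith f c is ps qs
AllVI-zipWith f c (edge a t ∷ is) (p , ps) (q , qs) =
  AllV-zipWith f (just (c , a)) t p q , AllVI-zipWith f c is ps qs

module _ {A : Set} (f : A → ℕ) {k : ℕ} where
  open ≤-Reasoning

  sum-map-≤ : ∀ {xs} → All (λ x → f x ≤ k) xs → sum (map f xs) ≤ k * length xs
  sum-map-≤ [] = z≤n
  sum-map-≤ {x ∷ xs} (fx≤k ∷ bounds) = begin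
    f x + sum (map f xs) ≤⟨ +-mono-≤ fx≤k (sum-map-≤ bounds) ⟩
    k + k * length xs    ≡⟨ *-suc k (length xs) ⟨
    k * length (x ∷ xs)  ∎

  sum-map-+-≤ : ∀ {xs} → All (λ x → f x ≤ k) xs → Any (λ x → f x ≡ 0) xs →
    sum (map f xs) + k ≤ k * length xs
  sum-map-+-≤ {x ∷ xs} (_ ∷ bounds) (here fx≡0) = begin
    f x + sum (map f xs) + k ≡⟨ cong (λ n → n + sum (map f xs) + k) fx≡0 ⟩
    sum (map f xs) + k       ≤⟨ +-monoˡ-≤ k (sum-map-≤ bounds) ⟩
    k * length xs + k        ≡⟨ +-comm (k * length xs) k ⟩
    k + k * length xs        ≡⟨ *-suc k (length xs) ⟨
    k * length (x ∷ xs)      ∎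
  sum-map-+-≤ {x ∷ xs} (fx≤k ∷ bounds) (there zero∈xs) = begin
    f x + sum (map f xs) + k   ≡⟨ +-assoc (f x) _ k ⟩
    f x + (sum (map f xs) + k) ≤⟨ +-mono-≤ fx≤k (sum-map-+-≤ bounds zero∈xs) ⟩
    k + k * length xs          ≡⟨ *-suc k (length xs) ⟨
    k * length (x ∷ xs)        ∎

  ≤-sum-map : ∀ {xs} → Any (λ x → k ≤ f x) xs → k ≤ sum (map f xs)
  ≤-sum-map {x ∷ xs} (here k≤fx) = ≤-trans k≤fx (m≤m+n (f x) _)
  ≤-sum-map {x ∷ xs} (there k≤∈xs) = ≤-trans (≤-sum-map k≤∈xs) (m≤n+m _ (f x))

module _ {k : ℕ} where
  open ≤-Reasoning

  itemOut-≤ : ∀ is → All (_≤ k) (edgeVals is) → All (λ x → itemOut k x ≤ k) is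
  itemOut-≤ [] _ = []
  itemOut-≤ (stem opening ∷ is) bounds = ≤-refl ∷ itemOut-≤ is bounds
  itemOut-≤ (stem closing ∷ is) bounds = z≤n ∷ itemOut-≤ is bounds
  itemOut-≤ (edge a _ ∷ is) (a≤k ∷ bounds) = a≤k ∷ itemOut-≤ is bounds

  upOut-+-≤ : ∀ up is → upOut k up + k * length is ≤ k * deg up is
  upOut-+-≤ nothing is = ≤-refl
  upOut-+-≤ (just (_ , a)) is = begin
    k ∸ a + k * length is ≤⟨ +-monoˡ-≤ (k * length is) (m∸n≤m k a) ⟩
    k + k * length is     ≡⟨ *-suc k (length is) ⟨
    k * suc (length is)   ∎

  outdeg-+-≤ : ∀ up is → All (_≤ k) (edgeVals is) → stem closing ∈ is →
    outdeg k up is + k ≤ k * deg up is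
  outdeg-+-≤ up is frac closing∈is = begin
    upOut k up + sum (map (itemOut k) is) + k   ≡⟨ +-assoc (upOut k up) _ k ⟩
    upOut k up + (sum (map (itemOut k) is) + k) ≤⟨ +-monoʳ-≤ (upOut k up) items-≤ ⟩
    upOut k up + k * length is                  ≤⟨ upOut-+-≤ up is ⟩
    k * deg up is                               ∎
    where
    items-≤ : sum (map (itemOut k) is) + k ≤ k * length is
    items-≤ = sum-map-+-≤ (itemOut k) (itemOut-≤ is frac) (Any.map (λ { refl → refl }) closing∈is)

  ≤-outdeg : ∀ up is → stem opening ∈ is → k ≤ outdeg k up is
  ≤-outdeg up is opening∈is =
    ≤-trans (≤-sum-map (itemOut k) (Any.map (λ { refl → ≤-refl }) opening∈is))
            (m≤n+m _ (upOut k up))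

module _ (d : ℕ) (up : Up) {is : List Item} (degree : deg up is ≤ d) where

  opening-at-black : ∀ {c} → AlphaOutAt d up c is → stem opening ∈ is → c ≡ black
  opening-at-black {black} _ _ = refl
  opening-at-black {white} alpha opening∈is =
    ⊥-elim (n≮n d (≤-trans (≤-outdeg up is opening∈is) (≤-trans (≤-reflexive alpha) degree)))

  closing-at-white : ∀ {c} → FracAt (suc d) up c is → AlphaOutAt d up c is →
    stem closing ∈ is → c ≡ white
  closing-at-white {white} _ _ _ = refl
  closing-at-white {black} frac alpha closing∈is = ⊥-elim (n≮n d (≤-trans k≤D degree))
    where
    open ≤-Reasoning
    D = deg up is
    k≤D : suc d ≤ D
    k≤D = +-cancelˡ-≤ (d * D) (suc d) D (begin
      d * D + suc d                  ≡⟨ cong (_+ suc d) alpha ⟨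
      outdeg (suc d) up is + suc d   ≤⟨ outdeg-+-≤ up is frac closing∈is ⟩
      D + d * D                      ≡⟨ +-comm D (d * D) ⟩
      d * D + D                      ∎)

stemOK-at-alpha-vertex : ∀ d up {c is} → DegAtMost d up c is → FracAt (suc d) up c is →
  AlphaOutAt d up c is → All (StemOK c) is
stemOK-at-alpha-vertex d up degree frac alpha = All.tabulate stemOK
  where
  stemOK : ∀ {x} → x ∈ _ → StemOK _ x
  stemOK {stem opening} x∈is = opening-at-black d up degree alpha x∈is
  stemOK {stem closing} x∈is = closing-at-white d up degree frac alpha x∈is
  stemOK {edge _ _} _ = tt

childRoot-color-differs : ∀ {c is a} {i : PosI is} → AllVI ProperAt c is →
  ChildRoot a i → c ≢ colorAtI i
childRoot-color-differs {is = edge _ (node _ _) ∷ _} (proper , _) hdR = proj₁ proper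
childRoot-color-differs {is = stem _ ∷ _} proper (tlR r) = childRoot-color-differs proper r
childRoot-color-differs {is = edge _ _ ∷ _} (_ , proper) (tlR r) = childRoot-color-differs proper r

treeEdge-colors-differ : ∀ {up t a} {p q : Pos t} → AllV ProperAt up t →
  Step a toChild p q → colorAt p ≢ colorAt q
treeEdgeI-colors-differ : ∀ {c is a} {i j : PosI is} → AllVI ProperAt c is →
  StepI a toChild i j → colorAtI i ≢ colorAtI j
treeEdge-colors-differ {t = node _ _} (_ , proper) (sDown r) = childRoot-color-differs proper r
treeEdge-colors-differ {t = node _ _} (_ , proper) (sIn s) = treeEdgeI-colors-differ proper s
treeEdgeI-colors-differ {is = edge _ _ ∷ _} (proper , _) (iHd s) = treeEdge-colors-differ proper s
treeEdgeI-colors-differ {is = stem _ ∷ _} proper (iTl s) = treeEdgeI-colors-differ proper s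
treeEdgeI-colors-differ {is = edge _ _ ∷ _} (_ , proper) (iTl s) = treeEdgeI-colors-differ proper s

stemColor : StemKind → Color
stemColor opening = black
stemColor closing = white

StemColored : {P : Set} → (P → Color) → StemKind × P → Set
StemColored col (s , p) = col p ≡ stemColor s

StemOK-stem : ∀ {c} s → StemOK c (stem s) → c ≡ stemColor s
StemOK-stem opening c≡black = c≡black
StemOK-stem closing c≡white = c≡white

StemsAt : Up → Color → List Item → Set
StemsAt up c is = All (StemOK c) is

-- In stemsI is h f, h is the vertex carrying is and f embeds its descendants into T.
stems-colored : ∀ {up} t → AllV StemsAt up t → All (StemColored colorAt) (stems t)
stemsI-colored : ∀ {T c} is (h : Pos T) (f : PosI is → Pos T) → colorAt h ≡ c →
  (∀ i → colorAt (f i) ≡ colorAtI i) → All (StemOK c) is → AllVI StemsAt c is →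
  All (StemColored colorAt) (stemsI is h f)
stems-colored (node c is) (ok , oks) = stemsI-colored is here down refl (λ _ → refl) ok oks
stemsI-colored [] h f h≡c f≡ _ _ = []
stemsI-colored (stem s ∷ is) h f h≡c f≡ (ok ∷ ok-is) oks =
  trans h≡c (StemOK-stem s ok) ∷ stemsI-colored is h (λ i → f (tl i)) h≡c (λ i → f≡ (tl i)) ok-is oks
stemsI-colored (edge a t ∷ is) h f h≡c f≡ (_ ∷ ok-is) (oks-t , oks) =
  ++⁺ (map⁺ (All.map (λ {x} → trans (f≡ (hd (proj₂ x)))) (stems-colored t oks-t)))
      (stemsI-colored is h (λ i → f (tl i)) h≡c (λ i → f≡ (tl i)) ok-is oks)

module _ {P : Set} (Q : StemKind × P → Set) where

  MatchedPair : P × P → Set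
  MatchedPair (p , q) = Q (opening , p) × Q (closing , q)

  zip-matched : ∀ {xs ys} → All (λ p → Q (opening , p)) xs → All (λ q → Q (closing , q)) ys →
    All MatchedPair (zip xs ys)
  zip-matched [] _ = []
  zip-matched (_ ∷ _) [] = []
  zip-matched (qp ∷ qps) (qq ∷ qqs) = (qp , qq) ∷ zip-matched qps qqs

  matchGo-matched : ∀ st uc xs → All (λ p → Q (opening , p)) st →
    All (λ q → Q (closing , q)) uc → All Q xs → All MatchedPair (matchGo st uc xs)
  matchGo-matched st uc [] qst quc _ =
    zip-matched qst (All-resp-↭ (↭-sym (↭-reverse uc)) quc)
  matchGo-matched st uc ((opening , p) ∷ xs) qst quc (qx ∷ qxs) =
    matchGo-matched (p ∷ st) uc xs (qx ∷ qst) quc qxs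
  matchGo-matched (q ∷ st) uc ((closing , p) ∷ xs) (qq ∷ qst) quc (qx ∷ qxs) =
    (qq , qx) ∷ matchGo-matched st uc xs qst quc qxs
  matchGo-matched [] uc ((closing , p) ∷ xs) qst quc (qx ∷ qxs) =
    matchGo-matched [] (p ∷ uc) xs qst (qx ∷ quc) qxs

closureEdges-bicolored : ∀ t → StemsColored t →
  All (λ e → colorAt (proj₁ e) ≢ colorAt (proj₂ e)) (closureEdges t)
closureEdges-bicolored t colored =
  All.map (λ {e} → black≢white {e}) (matchGo-matched (StemColored colorAt) [] [] (stems t) [] []
    (stems-colored t colored))
  where
  black≢white : ∀ {e : Pos t × Pos t} → MatchedPair (StemColored colorAt) e →
    colorAt (proj₁ e) ≢ colorAt (proj₂ e)
  black≢white {_ , _} (p-black , q-white) p≡q with trans (sym p-black) (trans p≡q q-white)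
  ... | ()

lemma2p8 : (d : ℕ) → 1 ≤ d → (t : Tree) → AlphaTree d t →
    StemsColored t × BipartiteClosure t
lemma2p8 d _ t (proper , degree , frac , alpha , _) =
  colored , colorAt , (λ (_ , s) → treeEdge-colors-differ proper s) ,
  closureEdges-bicolored t colored
  where
  colored : StemsColored t
  colored = AllV-zipWith (λ {up} degree-up (frac-up , alpha-up) →
                            stemOK-at-alpha-vertex d up degree-up frac-up alpha-up)
              nothing t degree (AllV-zipWith _,_ nothing t frac alpha)
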